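{- Let $\widehat{X}$ be a sandpile graph and let $u,a\in\mathcal{M}(\widehat{X})$ with $u\oplus a=u$. If $a\neq0$, then $a$ cannot access $0$; that is, there is no $k\in\mathcal{M}(\widehat{X})$ with $a\oplus k=0$.
   Context: A sandpile graph $\widehat{X}$ is a finite weakly connected directed multigraph (loops and multiple edges allowed) with a distinguished vertex, the sink, reachable by a directed path from every vertex; the set of non-sink vertices is nonempty. A configuration assigns a nonnegative integer number of grains to each non-sink vertex; it is stable if every $v$ holds fewer than $\deg^{+}(v)$ (out-degree) grains. Toppling an unstable vertex sends one grain along each of its out-edges (grains at the sink vanish; the sink never topples); every configuration has a unique stabilization. $\mathcal{M}(\widehat X)$ is the set of stable configurations with $a\oplus b$ = stabilization of $a+b$, a commutative monoid whose identity $0$ is the empty configuration. -}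

module Defs where

open import Data.Nat using (ℕ; zero; suc; _+_; _∸_; _≤_; _<_; NonZero)
open import Data.Fin using (Fin; _≟_)
open import Data.Vec.Functional using (foldr)
open import Data.Product using (Σ; _×_; _,_)
open import Relation.Nullary using (¬_; yes; no)
open import Relation.Binary.PropositionalEquality using (_≡_)
open import Relation.Binary.Construct.Closure.ReflexiveTransitive using (Star)

∑ : ∀ {n} → (Fin n → ℕ) → ℕ
∑ f = foldr _+_ 0 f

-- A sandpile graph with n non-sink vertices (Fin n) and one extra sink.
-- adj v w  = number of directed edges v → w between non-sink vertices
--            (loops v → v and multiple edges allowed),
-- toSink v = number of directed edges v → sink.
-- Edges out of the sink play no role in the monoid and are omitted
-- (weak connectivity follows from reachability of the sink).
data Reaches {n : ℕ} (adj : Fin n → Fin n → ℕ) (toSink : Fin n → ℕ) : Fin n → Set where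
  direct : ∀ {v} → 0 < toSink v → Reaches adj toSink v
  via    : ∀ {v w} → 0 < adj v w → Reaches adj toSink w → Reaches adj toSink v

record SandpileGraph (n : ℕ) : Set where
  field
    nonempty : NonZero n
    adj      : Fin n → Fin n → ℕ
    toSink   : Fin n → ℕ
    sinkReachable : ∀ v → Reaches adj toSink v

  outdeg : Fin n → ℕ
  outdeg v = ∑ (adj v) + toSink v

Config : ℕ → Set
Config n = Fin n → ℕ

_⊞_ : ∀ {n} → Config n → Config n → Config n
(a ⊞ b) v = a v + b v

zeroConfig : ∀ {n} → Config n
zeroConfig _ = 0

module _ {n : ℕ} (G : SandpileGraph n) where
  open SandpileGraph G

  Stable : Config n → Set
  Stable c = ∀ v → c v < outdeg v

  topple : Fin n → Config n → Config n
  topple v c w with w ≟ v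
  ... | yes _ = (c w ∸ outdeg v) + adj v w
  ... | no  _ = c w + adj v w

  data Topple : Config n → Config n → Set where
    topple-step : ∀ {c} v → outdeg v ≤ c v → Topple c (topple v c)

  Stabilizes : Config n → Config n → Set
  Stabilizes c s = Σ (Config n) λ c' → Star Topple c c' × (∀ v → c' v ≡ s v) × Stable s

  OplusIs : Config n → Config n → Config n → Set
  OplusIs a b s = Stabilizes (a ⊞ b) s

-- Let the toppling sequence of a ⊕ k end in 0, and call a vertex silent if it
-- never fires there. A silent vertex only gains grains, so a vanishes on it,
-- and no firing vertex has an edge into it. Hence, in the stabilization of
-- u + a, a silent vertex can never become unstable (it holds at most its
-- stable value in u) and never receives grains: it stays silent. So the
-- vertices firing in u ⊕ a all fire in a ⊕ k; among them the one whose last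
-- firing in a ⊕ k comes first receives no edge from the others. Since u ⊕ a
-- returns u, that vertex must have lost exactly the grains of a there, which
-- is a positive multiple of its out-degree, contradicting stability of a.
-- If no vertex fires in u ⊕ a at all, then a = 0.
module Submission where

open import Defs
open import Data.Nat using (ℕ; suc; _+_; _*_; _∸_; _≤_; _<_; _<?_; z<s; >-nonZero) renaming (_≟_ to _≟ℕ_)
open import Data.Nat.Properties hiding (_≟_)
open import Data.Fin using (Fin; _≟_)
open import Data.Fin.Properties using (any?)
open import Data.Product using (Σ; ∃; _×_; _,_)
open import Relation.Nullary using (¬_; yes; no; Dec; contradiction)
open import Function using (_∘_)
open import Relation.Binary.PropositionalEquality
open import Relation.Binary.Construct.Closure.ReflexiveTransitive using (Star; ε; _◅_)

module Toppling {n : ℕ} (G : SandpileGraph n) where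
  open SandpileGraph G

  topple-self : ∀ v c → topple G v c v ≡ c v ∸ outdeg v + adj v v
  topple-self v c with v ≟ v
  ... | yes _ = refl
  ... | no v≢v = contradiction refl v≢v

  topple-other : ∀ {w} v c → w ≢ v → topple G v c w ≡ c w + adj v w
  topple-other {w} v c w≢v with w ≟ v
  ... | yes w≡v = contradiction w≡v w≢v
  ... | no _ = refl

  adj≤topple : ∀ v c w → adj v w ≤ topple G v c w
  adj≤topple v c w with w ≟ v
  ... | yes _ = m≤n+m (adj v w) _
  ... | no _ = m≤n+m (adj v w) (c w)

  Topplings : Config n → Config n → Set
  Topplings = Star (Topple G)

  odometer : ∀ {c c'} → Topplings c c' → Config n
  odometer ε w = 0
  odometer (topple-step v _ ◅ s) w with w ≟ v
  ... | yes _ = suc (odometer s w)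
  ... | no _ = odometer s w

  Silent Fires : ∀ {c c'} → Topplings c c' → Fin n → Set
  Silent s w = odometer s w ≡ 0
  Fires s w = 0 < odometer s w

  module _ {c c'} v (p : outdeg v ≤ c v) (s : Topplings (topple G v c) c') where

    odometer-self : odometer (topple-step v p ◅ s) v ≡ suc (odometer s v)
    odometer-self with v ≟ v
    ... | yes _ = refl
    ... | no v≢v = contradiction refl v≢v

    odometer-other : ∀ {w} → w ≢ v → odometer (topple-step v p ◅ s) w ≡ odometer s w
    odometer-other {w} w≢v with w ≟ v
    ... | yes w≡v = contradiction w≡v w≢v
    ... | no _ = refl

    odometer-tail≤ : ∀ w → odometer s w ≤ odometer (topple-step v p ◅ s) w
    odometer-tail≤ w with w ≟ v
    ... | yes _ = n≤1+n _
    ... | no _ = ≤-refl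

    tail-fires⇒fires : ∀ {w} → Fires s w → Fires (topple-step v p ◅ s) w
    tail-fires⇒fires {w} fires = ≤-trans fires (odometer-tail≤ w)

    head-fires : Fires (topple-step v p ◅ s) v
    head-fires = subst (0 <_) (sym odometer-self) z<s

    silent-tail : ∀ {w} → Silent (topple-step v p ◅ s) w → w ≢ v × Silent s w
    silent-tail {w} silent with w ≟ v
    ... | no w≢v = w≢v , silent

    fires-tail : ∀ {w} → w ≢ v → Fires (topple-step v p ◅ s) w → Fires s w
    fires-tail w≢v = subst (0 <_) (odometer-other w≢v)

    fires-tail-on : {X : Fin n → Set} → (X v → Fires s v) →
                    (∀ t → X t → Fires (topple-step v p ◅ s) t) → ∀ t → X t → Fires s t
    fires-tail-on fires-v fires t xt with t ≟ v
    ... | yes refl = fires-v xt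
    ... | no t≢v = fires-tail t≢v (fires t xt)

  silent⇒≤ : ∀ {c c' w} (s : Topplings c c') → Silent s w → c w ≤ c' w
  silent⇒≤ ε _ = ≤-refl
  silent⇒≤ {c} {w = w} (topple-step v p ◅ s) silent with silent-tail v p s silent
  ... | w≢v , silent-s = begin
    c w                 ≤⟨ m≤m+n (c w) (adj v w) ⟩
    c w + adj v w       ≡⟨ topple-other v c w≢v ⟨
    topple G v c w      ≤⟨ silent⇒≤ s silent-s ⟩
    _                   ∎
    where open ≤-Reasoning

  silent⇒adj≤ : ∀ {c c' w t} (s : Topplings c c') → Silent s w → Fires s t → adj t w ≤ c' w
  silent⇒adj≤ {c} {w = w} {t} (topple-step v p ◅ s) silent fires
    with silent-tail v p s silent | t ≟ v
  ... | _ , silent-s | yes refl = ≤-trans (adj≤topple v c w) (silent⇒≤ s silent-s)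
  ... | _ , silent-s | no t≢v = silent⇒adj≤ s silent-s (fires-tail v p s t≢v fires)

  IsZero : Config n → Set
  IsZero c = ∀ v → c v ≡ 0

  ≤zero⇒≡0 : ∀ {c m w} → IsZero c → m ≤ c w → m ≡ 0
  ≤zero⇒≡0 {w = w} c≡0 m≤cw = n≤0⇒n≡0 (≤-trans m≤cw (≤-reflexive (c≡0 w)))

  -- Among the firing vertices in X, take the one whose last firing comes first.
  ∃-unfed-firer : ∀ {c c'} (s : Topplings c c') → IsZero c' →
                  (X : Fin n → Set) → (∀ t → Dec (X t)) → (∀ t → X t → Fires s t) →
                  ∃ X → Σ (Fin n) λ w → X w × (∀ t → X t → adj t w ≡ 0)
  ∃-unfed-firer ε _ _ _ fires (t , xt) with fires t xt
  ... | ()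
  ∃-unfed-firer {c} (topple-step v p ◅ s) c'≡0 X X? fires x
    with X? v | odometer s v ≟ℕ 0
  ... | yes xv | yes silent = v , xv , unfed
    where
      unfed : ∀ t → X t → adj t v ≡ 0
      unfed t xt with t ≟ v
      ... | yes refl = ≤zero⇒≡0 c'≡0 (≤-trans (adj≤topple v c v) (silent⇒≤ s silent))
      ... | no t≢v = ≤zero⇒≡0 c'≡0 (silent⇒adj≤ s silent (fires-tail v p s t≢v (fires t xt)))
  ... | yes _ | no loud =
    ∃-unfed-firer s c'≡0 X X? (fires-tail-on v p s (λ _ → n≢0⇒n>0 loud) fires) x
  ... | no ¬xv | _ =
    ∃-unfed-firer s c'≡0 X X? (fires-tail-on v p s (λ xv → contradiction xv ¬xv) fires) x

  silent-preserved : ∀ {c₀ c₀' c c' u} (ys : Topplings c₀ c₀') → IsZero c₀' → Stable G u →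
                     (∀ w → Silent ys w → c w ≤ u w) →
                     (s : Topplings c c') → ∀ w → Silent ys w → Silent s w
  silent-preserved ys ys≡0 stable-u below ε w silent = refl
  silent-preserved {c = c} {u = u} ys ys≡0 stable-u below (topple-step v p ◅ s) w silent
    with odometer ys v ≟ℕ 0
  ... | yes silent-v = contradiction (≤-trans p (below v silent-v)) (<⇒≱ (stable-u v))
  ... | no loud-v =
    trans (odometer-other v p s (w≢v silent))
          (silent-preserved ys ys≡0 stable-u below′ s w silent)
    where
      w≢v : ∀ {w} → Silent ys w → w ≢ v
      w≢v silent refl = loud-v silent

      below′ : ∀ w → Silent ys w → topple G v c w ≤ u w
      below′ w silent = begin
        topple G v c w  ≡⟨ topple-other v c (w≢v silent) ⟩
        c w + adj v w   ≡⟨ cong (c w +_) (≤zero⇒≡0 ys≡0 (silent⇒adj≤ ys silent (n≢0⇒n>0 loud-v))) ⟩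
        c w + 0         ≡⟨ +-identityʳ (c w) ⟩
        c w             ≤⟨ below w silent ⟩
        u w             ∎
        where open ≤-Reasoning

  odometer-balance : ∀ {c c' w} (s : Topplings c c') → (∀ t → Fires s t → adj t w ≡ 0) →
                     c w ≡ c' w + odometer s w * outdeg w
  odometer-balance {c} ε _ = sym (+-identityʳ _)
  odometer-balance {c} {c'} {w} (topple-step v p ◅ s) unfed with w ≟ v
  ... | yes refl = begin
    c w                                         ≡⟨ m∸n+n≡m p ⟨
    c w ∸ outdeg w + outdeg w                   ≡⟨ cong (_+ outdeg w) after-topple ⟩
    c' w + odometer s w * outdeg w + outdeg w   ≡⟨ +-assoc (c' w) _ _ ⟩
    c' w + (odometer s w * outdeg w + outdeg w) ≡⟨ cong (c' w +_) (+-comm _ (outdeg w)) ⟩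
    c' w + suc (odometer s w) * outdeg w        ∎
    where
      open ≡-Reasoning
      after-topple : c w ∸ outdeg w ≡ c' w + odometer s w * outdeg w
      after-topple = begin
        c w ∸ outdeg w              ≡⟨ +-identityʳ _ ⟨
        c w ∸ outdeg w + 0          ≡⟨ cong (c w ∸ outdeg w +_) (unfed w (head-fires w p s)) ⟨
        c w ∸ outdeg w + adj w w    ≡⟨ topple-self w c ⟨
        topple G w c w              ≡⟨ odometer-balance s (λ t → unfed t ∘ tail-fires⇒fires w p s) ⟩
        c' w + odometer s w * outdeg w ∎
  ... | no w≢v = begin
    c w                  ≡⟨ +-identityʳ _ ⟨
    c w + 0              ≡⟨ cong (c w +_) (unfed v (head-fires v p s)) ⟨
    c w + adj v w        ≡⟨ topple-other v c w≢v ⟨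
    topple G v c w       ≡⟨ odometer-balance s (λ t → unfed t ∘ tail-fires⇒fires v p s) ⟩
    c' w + odometer s w * outdeg w ∎
    where open ≡-Reasoning

  absorbed-grains : ∀ {u a cu w} (us : Topplings (u ⊞ a) cu) → (∀ w → cu w ≡ u w) →
                    (∀ t → Fires us t → adj t w ≡ 0) → a w ≡ odometer us w * outdeg w
  absorbed-grains {u} {w = w} us us≡u unfed =
    +-cancelˡ-≡ (u w) _ _ (trans (odometer-balance us unfed) (cong (_+ odometer us w * outdeg w) (us≡u w)))

  absorbing⇒annihilating-fires : ∀ {u a k cu cz} → Stable G u →
                                  (us : Topplings (u ⊞ a) cu) →
                                  (ys : Topplings (a ⊞ k) cz) → IsZero cz →
                                  ∀ t → Fires us t → Fires ys t
  absorbing⇒annihilating-fires {u} {a} {k} stable-u us ys ys≡0 t fires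
    with odometer ys t ≟ℕ 0
  ... | yes silent = contradiction (silent-preserved ys ys≡0 stable-u a-silent us t silent) (n>0⇒n≢0 fires)
    where
      a-silent : ∀ w → Silent ys w → u w + a w ≤ u w
      a-silent w silent = begin
        u w + a w   ≡⟨ cong (u w +_) (≤zero⇒≡0 ys≡0 (≤-trans (m≤m+n (a w) (k w)) (silent⇒≤ ys silent))) ⟩
        u w + 0     ≡⟨ +-identityʳ (u w) ⟩
        u w         ∎
        where open ≤-Reasoning
  ... | no loud = n≢0⇒n>0 loud

  absorbed-annihilated⇒zero : ∀ {u a k cu cz} → Stable G u → Stable G a →
                              (us : Topplings (u ⊞ a) cu) → (∀ w → cu w ≡ u w) →
                              (ys : Topplings (a ⊞ k) cz) → IsZero cz → IsZero a
  absorbed-annihilated⇒zero {u} {a} stable-u stable-a us us≡u ys ys≡0 w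
    with any? (λ t → 0 <? odometer us t)
  ... | no none = begin
    a w                         ≡⟨ absorbed-grains us us≡u (λ t fires → contradiction (t , fires) none) ⟩
    odometer us w * outdeg w    ≡⟨ cong (_* outdeg w) (n≤0⇒n≡0 (≮⇒≥ (λ fires → none (w , fires)))) ⟩
    0                           ∎
    where open ≡-Reasoning
  ... | yes firer
    with ∃-unfed-firer ys ys≡0 (Fires us) (λ t → 0 <? odometer us t)
                       (absorbing⇒annihilating-fires stable-u us ys ys≡0) firer
  ... | v , fires , unfed = contradiction outdeg≤a (<⇒≱ (stable-a v))
    where
      outdeg≤a : outdeg v ≤ a v
      outdeg≤a = begin
        outdeg v                  ≤⟨ m≤n*m (outdeg v) (odometer us v) {{>-nonZero fires}} ⟩
        odometer us v * outdeg v  ≡⟨ absorbed-grains us us≡u unfed ⟨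
        a v                       ∎
        where open ≤-Reasoning

theorem5p2 : {n : ℕ} (G : SandpileGraph n) (u a : Config n)
    → Stable G u → Stable G a
    → OplusIs G u a u
    → ¬ (∀ v → a v ≡ 0)
    → ¬ (Σ (Config n) λ k → Stable G k × OplusIs G a k zeroConfig)
theorem5p2 G u a stable-u stable-a (_ , us , us≡u , _) a≢0 (_ , _ , _ , ys , ys≡0 , _) =
  a≢0 (absorbed-annihilated⇒zero stable-u stable-a us us≡u ys ys≡0)
  where open Toppling G
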